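{- Consider the algorithm TRIÈST-BASE with integer parameter $M\ge6$ run on an insertion-only edge stream (described in the context). After each call to UpdateCounters, we have $\tau=|\Delta^{\mathcal{S}}|$ and $\tau_v=|\Delta^{\mathcal{S}}_v|$ for any vertex $v$ of $G^{\mathcal{S}}$ such that $|\Delta^{\mathcal{S}}_v|\ge 1$, where $\mathcal{S}$ is the current sample.
   Context: Insertion-only edge stream: a sequence $e_1,e_2,\dots$ of distinct undirected edges in arbitrary order. A triangle is a set of three edges $\{(u,v),(v,w),(w,u)\}$ with $u,v,w$ distinct, and $u,v,w$ are its corners. For an edge set $\mathcal{S}$, $G^{\mathcal{S}}$ is the graph with edge set $\mathcal{S}$, $\Delta^{\mathcal{S}}$ is the set of triangles of $G^{\mathcal{S}}$, $\Delta^{\mathcal{S}}_v$ the set of those having $v$ as a corner, and $\mathcal{N}^{\mathcal{S}}_{u,v}$ is the set of vertices adjacent in $G^{\mathcal{S}}$ to both $u$ and $v$. TRIÈST-BASE keeps an edge sample $\mathcal{S}$ (initially empty), a global counter $\tau$ (initially $0$) and local counters $\tau_c$ (value $0$ when not stored). UpdateCounters$(\bullet,(u,v))$, $\bullet\in\{+,-\}$, computes $\mathcal{N}^{\mathcal{S}}_{u,v}$ for the current $\mathcal{S}$ and, for each $c\in\mathcal{N}^{\mathcal{S}}_{u,v}$, adds ($\bullet=+$) or subtracts ($\bullet=-$) $1$ to each of $\tau,\tau_c,\tau_u,\tau_v$. At time $t$, when $e_t=(u,v)$ arrives: if $t\le M$, $e_t$ is inserted in $\mathcal{S}$ and then UpdateCounters$(+,e_t)$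 is called; if $t>M$, a coin with heads probability $M/t$ is flipped; on heads an edge $(u',v')$ chosen uniformly at random from $\mathcal{S}$ is removed from $\mathcal{S}$, then UpdateCounters$(-,(u',v'))$ is called, then $e_t$ is inserted in $\mathcal{S}$ and UpdateCounters$(+,e_t)$ is called; on tails nothing changes. -}

module Defs where

open import Data.Nat using (ℕ; zero; suc; _≡ᵇ_; _≤ᵇ_; _≟_; _≤_)
open import Data.Integer as ℤ using (ℤ; +_; 0ℤ)
open import Data.Bool using (Bool; true; false; _∧_; _∨_; not; if_then_else_)
open import Data.List using (List; []; _∷_; _++_; map; filterᵇ; length; concatMap; deduplicate; removeAt; lookup; foldl)
open import Data.Bool.ListAction using (any)
open import Data.Fin using (Fin)
open import Data.Maybe using (Maybe; just; nothing)
open import Data.Product using (_×_; _,_; proj₁; proj₂)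
open import Data.Sum using (_⊎_)
open import Relation.Binary.PropositionalEquality using (_≡_)

-- Vertices are natural numbers; an (undirected) edge is given by its two endpoints.
Edge : Set
Edge = ℕ × ℕ

SameEdge : Edge → Edge → Set
SameEdge (a , b) (c , d) = (a ≡ c × b ≡ d) ⊎ (a ≡ d × b ≡ c)

sameEdgeᵇ : Edge → Edge → Bool
sameEdgeᵇ (a , b) (c , d) = ((a ≡ᵇ c) ∧ (b ≡ᵇ d)) ∨ ((a ≡ᵇ d) ∧ (b ≡ᵇ c))

distinct3ᵇ : ℕ → ℕ → ℕ → Bool
distinct3ᵇ u v w = not (u ≡ᵇ v) ∧ not (v ≡ᵇ w) ∧ not (w ≡ᵇ u)

-- Three edges e₁ e₂ e₃ form a triangle iff there are distinct u v w with
-- e₁ = {u,v}, e₂ = {v,w}, e₃ = {w,u}.  (Any listing of a triangle's edges can be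
-- labelled this way; u,v range over the endpoints of e₁ and w over those of e₂,
-- so this finite search decides the existential.)
isTriangleᵇ : Edge × Edge × Edge → Bool
isTriangleᵇ (e₁@(a , b) , e₂@(c , d) , e₃) =
  any (λ { (u , v , w) → distinct3ᵇ u v w ∧ sameEdgeᵇ e₁ (u , v)
                           ∧ sameEdgeᵇ e₂ (v , w) ∧ sameEdgeᵇ e₃ (w , u) })
      ((a , b , c) ∷ (a , b , d) ∷ (b , a , c) ∷ (b , a , d) ∷ [])

choose2 : {A : Set} → List A → List (A × A)
choose2 [] = []
choose2 (x ∷ xs) = map (x ,_) xs ++ choose2 xs

choose3 : {A : Set} → List A → List (A × A × A)
choose3 [] = []
choose3 (x ∷ xs) = map (λ p → x , p) (choose2 xs) ++ choose3 xs

triangles : List Edge → List (Edge × Edge × Edge)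
triangles S = filterᵇ isTriangleᵇ (choose3 S)

isEndpointᵇ : ℕ → Edge → Bool
isEndpointᵇ v (a , b) = (v ≡ᵇ a) ∨ (v ≡ᵇ b)

hasCornerᵇ : ℕ → Edge × Edge × Edge → Bool
hasCornerᵇ v (e₁ , e₂ , e₃) = isEndpointᵇ v e₁ ∨ isEndpointᵇ v e₂ ∨ isEndpointᵇ v e₃

trianglesAt : List Edge → ℕ → List (Edge × Edge × Edge)
trianglesAt S v = filterᵇ (hasCornerᵇ v) (triangles S)

-- vertices of G^S (endpoints of edges in S, possibly with repetitions)
vertices : List Edge → List ℕ
vertices = concatMap (λ { (a , b) → a ∷ b ∷ [] })

adjᵇ : List Edge → ℕ → ℕ → Bool
adjᵇ S x y = any (λ e → sameEdgeᵇ e (x , y)) S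

commonNbrs : List Edge → ℕ → ℕ → List ℕ
commonNbrs S u v = deduplicate _≟_ (filterᵇ (λ c → adjᵇ S u c ∧ adjᵇ S c v) (vertices S))

-- State of TRIÈST-BASE: sample 𝒮, global counter τ, local counters τ_c
-- (a total function; value 0 = counter not stored).
record State : Set where
  constructor st
  field
    sample : List Edge
    τ      : ℤ
    local  : ℕ → ℤ
open State public

initState : State
initState = st [] 0ℤ (λ _ → 0ℤ)

data Sign : Set where
  plus minus : Sign

signℤ : Sign → ℤ
signℤ plus  = + 1
signℤ minus = ℤ.- (+ 1)

bump : ℤ → ℕ → (ℕ → ℤ) → (ℕ → ℤ)
bump s x f y = if y ≡ᵇ x then f y ℤ.+ s else f y

updateCounters : Sign → Edge → State → State
updateCounters sg (u , v) σ =
  foldl (λ σ' c → st (sample σ') (τ σ' ℤ.+ s)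
                     (bump s v (bump s u (bump s c (local σ')))))
        σ (commonNbrs (sample σ) u v)
  where s = signℤ sg

insertEdge : Edge → State → State
insertEdge e σ = st (e ∷ sample σ) (τ σ) (local σ)

-- The random outcomes at time t > M, for current sample S:
-- nothing = tails; just i = heads and the i-th edge of S is the one removed.
-- (The claim holds for every outcome, so we quantify over all of them.)
Choices : Set
Choices = (t : ℕ) → (S : List Edge) → Maybe (Fin (length S))

-- Processing e_t: returns the states right after each UpdateCounters call
-- made at time t, and the state at the end of time t.
step : ℕ → Choices → ℕ → Edge → State → List State × State
step M ch t e σ with t ≤ᵇ M
... | true = let σ₁ = updateCounters plus e (insertEdge e σ) in (σ₁ ∷ [] , σ₁)
... | false with ch t (sample σ)
...   | nothing = ([] , σ)
...   | just i  =
  let e' = lookup (sample σ) i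
      σ₁ = updateCounters minus e' (st (removeAt (sample σ) i) (τ σ) (local σ))
      σ₂ = updateCounters plus e (insertEdge e σ₁)
  in (σ₁ ∷ σ₂ ∷ [] , σ₂)

runFrom : ℕ → Choices → ℕ → State → List Edge → List State
runFrom M ch t σ [] = []
runFrom M ch t σ (e ∷ es) with step M ch t e σ
... | (outs , σ') = outs ++ runFrom M ch (suc t) σ' es

trace : ℕ → Choices → List Edge → List State
trace M ch stream = runFrom M ch 1 initState stream

module Submission where

-- We prove a stronger invariant: after every call to UpdateCounters the sample
-- S is loop-free and simple, τ = |Δ^S|, and τ_x = |Δ^S_x| for EVERY vertex x.
-- Both changes of the sample reduce to one counting identity for adding an
-- edge uv to a loop-free simple S not containing it: the new triangles are
-- exactly {uv, uc, cv} for c ∈ 𝒩^S_{u,v}, hence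
--     |Δ^{uv∷S}|   = |𝒩^S_{u,v}| + |Δ^S|,
--     |Δ^{uv∷S}_x| = |{c ∈ 𝒩^S_{u,v} : x ∈ {c,u,v}}| + |Δ^S_x|.
-- UpdateCounters(±,uv) adds ±1 to τ, τ_c, τ_u, τ_v for each c ∈ 𝒩, i.e. exactly
-- ± the right-hand corrections.  Insertion follows directly (𝒩 is the same
-- whether or not uv is already sampled); removal of e follows because triangle
-- counts are invariant under permuting the sample, and S ↭ e ∷ (S without e).

open import Defs
open import Data.Nat using (ℕ; suc; _+_; _≤_; _≡ᵇ_; _≤ᵇ_; _≟_)
open import Data.Nat.Properties using (≡ᵇ⇒≡; ≡⇒≡ᵇ; +-comm; +-commutativeSemigroup)
open import Algebra.Properties.CommutativeSemigroup +-commutativeSemigroup using (interchange; x∙yz≈y∙xz)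
open import Data.Integer as ℤ using (ℤ; +_; -1ℤ)
import Data.Integer.Properties as ℤP
open import Data.Bool using (Bool; true; false; _∧_; _∨_; not; if_then_else_; T)
open import Data.Bool.Properties using (T-≡; T-not-≡; T-∧; T-∨; ∨-assoc; ∨-comm; ∨-zeroʳ; ∧-identityʳ)
open import Data.Unit using (tt)
open import Data.Empty using (⊥-elim)
open import Data.Fin as Fin using (Fin)
open import Data.Maybe using (just; nothing)
open import Data.Product using (_×_; _,_; proj₁; proj₂; ∃)
open import Data.Sum using (_⊎_; inj₁; inj₂)
open import Data.List using (List; []; _∷_; _++_; map; filterᵇ; length; removeAt; lookup; foldl)
open import Data.List.Properties using (filter-++; filter-≐; length-++)
open import Data.List.Relation.Unary.Any using (here; there)
open import Data.List.Relation.Unary.Any.Properties using (any⁺; any⁻)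
open import Data.List.Relation.Unary.All as All using (All; []; _∷_)
open import Data.List.Relation.Unary.AllPairs as AllPairs using (AllPairs; []; _∷_)
import Data.List.Relation.Unary.AllPairs.Properties as AllPairsP
import Data.List.Relation.Unary.All.Properties as AllP
open import Data.List.Relation.Unary.Unique.Propositional using (Unique)
open import Data.List.Relation.Unary.Unique.DecPropositional.Properties _≟_ using (deduplicate-!)
open import Data.List.Membership.Propositional using (_∈_; find; lose)
open import Data.List.Membership.Propositional.Properties
  using (∈-++⁺ˡ; ∈-++⁺ʳ; ∈-++⁻; ∈-map⁺; ∈-map⁻; ∈-filter⁺; ∈-filter⁻; ∈-deduplicate⁺; ∈-deduplicate⁻)
open import Data.List.Membership.Propositional.Properties.WithK using (unique∧set⇒bag)
open import Data.List.Relation.Binary.BagAndSetEquality using (∼bag⇒↭)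
open import Data.List.Relation.Binary.Permutation.Propositional as ↭ using (_↭_; prep; swap)
open import Data.List.Relation.Binary.Permutation.Propositional.Properties using (All-resp-↭; ↭-length)
open import Function using (_∘_)
open import Function.Bundles using (Equivalence; mk⇔)
open import Relation.Nullary using (¬_)
open import Relation.Nullary.Decidable using (T?)
open import Relation.Binary.PropositionalEquality
  using (_≡_; _≢_; refl; sym; trans; cong; cong₂; subst; module ≡-Reasoning)

open Equivalence using (to; from)

private variable A B : Set

count : (A → Bool) → List A → ℕ
count p xs = length (filterᵇ p xs)

bit : Bool → ℕ
bit true  = 1
bit false = 0

count-∷ : (p : A → Bool) (x : A) (xs : List A) → count p (x ∷ xs) ≡ bit (p x) + count p xs
count-∷ p x xs with p x
... | true  = refl
... | false = refl

count-++ : (p : A → Bool) (xs ys : List A) → count p (xs ++ ys) ≡ count p xs + count p ys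
count-++ p xs ys = trans (cong length (filter-++ (T? ∘ p) xs ys)) (length-++ (filterᵇ p xs))

count-map : (p : B → Bool) (f : A → B) (xs : List A) → count p (map f xs) ≡ count (p ∘ f) xs
count-map p f []       = refl
count-map p f (x ∷ xs) = begin
  count p (f x ∷ map f xs)           ≡⟨ count-∷ p (f x) (map f xs) ⟩
  bit (p (f x)) + count p (map f xs) ≡⟨ cong (λ n → bit (p (f x)) + n) (count-map p f xs) ⟩
  bit (p (f x)) + count (p ∘ f) xs   ≡⟨ count-∷ (p ∘ f) x xs ⟨
  count (p ∘ f) (x ∷ xs)             ∎
  where open ≡-Reasoning

count-ext : (p q : A → Bool) → (∀ x → p x ≡ q x) → (xs : List A) → count p xs ≡ count q xs
count-ext p q p≗q xs = cong length (filter-≐ (T? ∘ p) (T? ∘ q) (p⊆q , q⊆p) xs)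
  where
  p⊆q = λ {x} → subst T (p≗q x)
  q⊆p = λ {x} → subst T (sym (p≗q x))

count-filter : (p q : A → Bool) (xs : List A) → count p (filterᵇ q xs) ≡ count (λ x → q x ∧ p x) xs
count-filter p q []       = refl
count-filter p q (x ∷ xs) rewrite count-∷ (λ y → q y ∧ p y) x xs with q x
... | true  = trans (count-∷ p x (filterᵇ q xs)) (cong (λ n → bit (p x) + n) (count-filter p q xs))
... | false = count-filter p q xs

count-true : (xs : List A) → count (λ _ → true) xs ≡ length xs
count-true []       = refl
count-true (x ∷ xs) = cong suc (count-true xs)

count-↭ : (p : A → Bool) {xs ys : List A} → xs ↭ ys → count p xs ≡ count p ys
count-↭ p ↭.refl = refl
count-↭ p (prep {xs} {ys} x xs↭ys) = begin
  count p (x ∷ xs)        ≡⟨ count-∷ p x xs ⟩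
  bit (p x) + count p xs  ≡⟨ cong (λ n → bit (p x) + n) (count-↭ p xs↭ys) ⟩
  bit (p x) + count p ys  ≡⟨ count-∷ p x ys ⟨
  count p (x ∷ ys)        ∎
  where open ≡-Reasoning
count-↭ p (swap {xs} {ys} x y xs↭ys) = begin
  count p (x ∷ y ∷ xs)                    ≡⟨ count-∷ p x (y ∷ xs) ⟩
  bit (p x) + count p (y ∷ xs)            ≡⟨ cong (λ n → bit (p x) + n) (count-∷ p y xs) ⟩
  bit (p x) + (bit (p y) + count p xs)    ≡⟨ x∙yz≈y∙xz (bit (p x)) (bit (p y)) (count p xs) ⟩
  bit (p y) + (bit (p x) + count p xs)    ≡⟨ cong (λ n → bit (p y) + (bit (p x) + n)) (count-↭ p xs↭ys) ⟩
  bit (p y) + (bit (p x) + count p ys)    ≡⟨ cong (λ n → bit (p y) + n) (count-∷ p x ys) ⟨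
  bit (p y) + count p (x ∷ ys)            ≡⟨ count-∷ p y (x ∷ ys) ⟨
  count p (y ∷ x ∷ ys)                    ∎
  where open ≡-Reasoning
count-↭ p (↭.trans xs↭ys ys↭zs) = trans (count-↭ p xs↭ys) (count-↭ p ys↭zs)

same-members⇒↭ : {xs ys : List A} → Unique xs → Unique ys
  → (∀ {z} → z ∈ xs → z ∈ ys) → (∀ {z} → z ∈ ys → z ∈ xs) → xs ↭ ys
same-members⇒↭ xs! ys! xs⊆ys ys⊆xs = ∼bag⇒↭ (unique∧set⇒bag xs! ys! (mk⇔ xs⊆ys ys⊆xs))

lookup-removeAt-↭ : (xs : List A) (i : Fin (length xs)) → xs ↭ lookup xs i ∷ removeAt xs i
lookup-removeAt-↭ (x ∷ xs) Fin.zero    = ↭.refl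
lookup-removeAt-↭ (x ∷ xs) (Fin.suc i) =
  ↭.trans (prep x (lookup-removeAt-↭ xs i)) (swap x (lookup xs i) ↭.refl)

All-removeAt : {P : A → Set} (xs : List A) (i : Fin (length xs)) → All P xs → All P (removeAt xs i)
All-removeAt xs i = All.tail ∘ All-resp-↭ (lookup-removeAt-↭ xs i)

removeAt-AllPairs : {R : A → A → Set} → (∀ {a b} → R a b → R b a) → (xs : List A) (i : Fin (length xs))
  → AllPairs R xs → All (R (lookup xs i)) (removeAt xs i) × AllPairs R (removeAt xs i)
removeAt-AllPairs R-sym (x ∷ xs) Fin.zero    (x~xs ∷ xs!) = x~xs , xs!
removeAt-AllPairs R-sym (x ∷ xs) (Fin.suc i) (x~xs ∷ xs!) =
  R-sym (All.head x~xs′) ∷ proj₁ rest , All.tail x~xs′ ∷ proj₂ rest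
  where
  rest = removeAt-AllPairs R-sym xs i xs!
  x~xs′ = All-resp-↭ (lookup-removeAt-↭ xs i) x~xs

Symmetric₂ : (A × A → Bool) → Set
Symmetric₂ p = ∀ a b → p (a , b) ≡ p (b , a)

Symmetric₃ : (A × A × A → Bool) → Set
Symmetric₃ p = (∀ a b c → p (a , b , c) ≡ p (b , a , c)) × (∀ a b c → p (a , b , c) ≡ p (a , c , b))

∧-symmetric₃ : {p q : A × A × A → Bool} → Symmetric₃ p → Symmetric₃ q → Symmetric₃ (λ t → p t ∧ q t)
∧-symmetric₃ (p₁₂ , p₂₃) (q₁₂ , q₂₃) =
  (λ a b c → cong₂ _∧_ (p₁₂ a b c) (q₁₂ a b c)) , (λ a b c → cong₂ _∧_ (p₂₃ a b c) (q₂₃ a b c))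

count-choose2-∷ : (p : A × A → Bool) (x : A) (xs : List A)
  → count p (choose2 (x ∷ xs)) ≡ count (λ y → p (x , y)) xs + count p (choose2 xs)
count-choose2-∷ p x xs =
  trans (count-++ p (map (x ,_) xs) (choose2 xs))
        (cong (λ n → n + count p (choose2 xs)) (count-map p (x ,_) xs))

count-choose3-∷ : (p : A × A × A → Bool) (x : A) (xs : List A)
  → count p (choose3 (x ∷ xs)) ≡ count (λ q → p (x , q)) (choose2 xs) + count p (choose3 xs)
count-choose3-∷ p x xs =
  trans (count-++ p (map (x ,_) (choose2 xs)) (choose3 xs))
        (cong (λ n → n + count p (choose3 xs)) (count-map p (x ,_) (choose2 xs)))

count-choose2-↭ : (p : A × A → Bool) → Symmetric₂ p → {xs ys : List A} → xs ↭ ys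
  → count p (choose2 xs) ≡ count p (choose2 ys)
count-choose2-↭ p p-sym ↭.refl = refl
count-choose2-↭ p p-sym (prep {xs} {ys} x xs↭ys) = begin
  count p (choose2 (x ∷ xs))                             ≡⟨ count-choose2-∷ p x xs ⟩
  count (λ y → p (x , y)) xs + count p (choose2 xs)
    ≡⟨ cong₂ _+_ (count-↭ (λ y → p (x , y)) xs↭ys) (count-choose2-↭ p p-sym xs↭ys) ⟩
  count (λ y → p (x , y)) ys + count p (choose2 ys)      ≡⟨ count-choose2-∷ p x ys ⟨
  count p (choose2 (x ∷ ys))                             ∎
  where open ≡-Reasoning
count-choose2-↭ p p-sym (swap {xs} {ys} x y xs↭ys) = begin
  count p (choose2 (x ∷ y ∷ xs))
    ≡⟨ trans (count-choose2-∷ p x (y ∷ xs)) (cong₂ _+_ (count-∷ px y xs) (count-choose2-∷ p y xs)) ⟩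
  (bit (p (x , y)) + count px xs) + (count py xs + count p (choose2 xs))
    ≡⟨ interchange (bit (p (x , y))) (count px xs) (count py xs) (count p (choose2 xs)) ⟩
  (bit (p (x , y)) + count py xs) + (count px xs + count p (choose2 xs))
    ≡⟨ cong₂ _+_ (cong₂ _+_ (cong bit (p-sym x y)) (count-↭ py xs↭ys))
                 (cong₂ _+_ (count-↭ px xs↭ys) (count-choose2-↭ p p-sym xs↭ys)) ⟩
  (bit (p (y , x)) + count py ys) + (count px ys + count p (choose2 ys))
    ≡⟨ trans (count-choose2-∷ p y (x ∷ ys)) (cong₂ _+_ (count-∷ py x ys) (count-choose2-∷ p x ys)) ⟨
  count p (choose2 (y ∷ x ∷ ys))
    ∎
  where
  open ≡-Reasoning
  px = λ z → p (x , z)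
  py = λ z → p (y , z)
count-choose2-↭ p p-sym (↭.trans xs↭ys ys↭zs) =
  trans (count-choose2-↭ p p-sym xs↭ys) (count-choose2-↭ p p-sym ys↭zs)

count-choose3-↭ : (p : A × A × A → Bool) → Symmetric₃ p → {xs ys : List A} → xs ↭ ys
  → count p (choose3 xs) ≡ count p (choose3 ys)
count-choose3-↭ p p-sym ↭.refl = refl
count-choose3-↭ p p-sym@(_ , swap₂₃) (prep {xs} {ys} x xs↭ys) = begin
  count p (choose3 (x ∷ xs))                                    ≡⟨ count-choose3-∷ p x xs ⟩
  count (λ q → p (x , q)) (choose2 xs) + count p (choose3 xs)
    ≡⟨ cong₂ _+_ (count-choose2-↭ (λ q → p (x , q)) (swap₂₃ x) xs↭ys) (count-choose3-↭ p p-sym xs↭ys) ⟩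
  count (λ q → p (x , q)) (choose2 ys) + count p (choose3 ys)   ≡⟨ count-choose3-∷ p x ys ⟨
  count p (choose3 (x ∷ ys))                                    ∎
  where open ≡-Reasoning
count-choose3-↭ p p-sym@(swap₁₂ , swap₂₃) (swap {xs} {ys} x y xs↭ys) = begin
  count p (choose3 (x ∷ y ∷ xs))
    ≡⟨ trans (count-choose3-∷ p x (y ∷ xs)) (cong₂ _+_ (count-choose2-∷ px y xs) (count-choose3-∷ p y xs)) ⟩
  (count pxy xs + count px (choose2 xs)) + (count py (choose2 xs) + count p (choose3 xs))
    ≡⟨ interchange (count pxy xs) (count px (choose2 xs)) (count py (choose2 xs)) (count p (choose3 xs)) ⟩
  (count pxy xs + count py (choose2 xs)) + (count px (choose2 xs) + count p (choose3 xs))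
    ≡⟨ cong₂ _+_ (cong₂ _+_ (trans (count-ext pxy pyx (swap₁₂ x y) xs) (count-↭ pyx xs↭ys))
                            (count-choose2-↭ py (swap₂₃ y) xs↭ys))
                 (cong₂ _+_ (count-choose2-↭ px (swap₂₃ x) xs↭ys) (count-choose3-↭ p p-sym xs↭ys)) ⟩
  (count pyx ys + count py (choose2 ys)) + (count px (choose2 ys) + count p (choose3 ys))
    ≡⟨ trans (count-choose3-∷ p y (x ∷ ys)) (cong₂ _+_ (count-choose2-∷ py x ys) (count-choose3-∷ p x ys)) ⟨
  count p (choose3 (y ∷ x ∷ ys))
    ∎
  where
  open ≡-Reasoning
  px = λ q → p (x , q)
  py = λ q → p (y , q)
  pxy = λ z → p (x , y , z)
  pyx = λ z → p (y , x , z)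
count-choose3-↭ p p-sym (↭.trans xs↭ys ys↭zs) =
  trans (count-choose3-↭ p p-sym xs↭ys) (count-choose3-↭ p p-sym ys↭zs)

choose2-∈⁻ : {f g : A} (xs : List A) → (f , g) ∈ choose2 xs → f ∈ xs × g ∈ xs
choose2-∈⁻ (x ∷ xs) m with ∈-++⁻ (map (x ,_) xs) m
... | inj₁ m₁ with ∈-map⁻ (x ,_) m₁
...   | y , y∈xs , refl = here refl , there y∈xs
choose2-∈⁻ (x ∷ xs) m | inj₂ m₂ =
  let (f∈xs , g∈xs) = choose2-∈⁻ xs m₂ in there f∈xs , there g∈xs

choose2-∈⁺ : {f g : A} (xs : List A) → f ∈ xs → g ∈ xs → f ≢ g
  → (f , g) ∈ choose2 xs ⊎ (g , f) ∈ choose2 xs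
choose2-∈⁺ (x ∷ xs) (here refl) (here refl) f≢g = ⊥-elim (f≢g refl)
choose2-∈⁺ (x ∷ xs) (here refl) (there g∈xs) _ = inj₁ (∈-++⁺ˡ (∈-map⁺ (x ,_) g∈xs))
choose2-∈⁺ (x ∷ xs) (there f∈xs) (here refl) _ = inj₂ (∈-++⁺ˡ (∈-map⁺ (x ,_) f∈xs))
choose2-∈⁺ (x ∷ xs) (there f∈xs) (there g∈xs) f≢g with choose2-∈⁺ xs f∈xs g∈xs f≢g
... | inj₁ m = inj₁ (∈-++⁺ʳ (map (x ,_) xs) m)
... | inj₂ m = inj₂ (∈-++⁺ʳ (map (x ,_) xs) m)

AllPairs-discharge : {P : A → Set} {R : A → A → Set} {xs : List A}
  → AllPairs (λ a b → P a → P b → R a b) xs → All P xs → AllPairs R xs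
AllPairs-discharge []         []         = []
AllPairs-discharge (r ∷ rs) (px ∷ pxs) =
  All.zipWith (λ (r′ , py) → r′ px py) (r , pxs) ∷ AllPairs-discharge rs pxs

≡ᵇ-refl : (n : ℕ) → (n ≡ᵇ n) ≡ true
≡ᵇ-refl n = to T-≡ (≡⇒≡ᵇ n n refl)

≡ᵇ-true⇒≡ : (m n : ℕ) → (m ≡ᵇ n) ≡ true → m ≡ n
≡ᵇ-true⇒≡ m n eq = ≡ᵇ⇒≡ m n (from T-≡ eq)

≡ᵇ-true-unique : (y : ℕ) {a b : ℕ} → (y ≡ᵇ a) ≡ true → (y ≡ᵇ b) ≡ true → a ≡ b
≡ᵇ-true-unique y {a} {b} y≡a y≡b = trans (sym (≡ᵇ-true⇒≡ y a y≡a)) (≡ᵇ-true⇒≡ y b y≡b)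

≢⇒T-not-≡ᵇ : {m n : ℕ} → m ≢ n → T (not (m ≡ᵇ n))
≢⇒T-not-≡ᵇ {m} {n} m≢n with m ≡ᵇ n in eq
... | true  = ⊥-elim (m≢n (≡ᵇ-true⇒≡ m n eq))
... | false = tt

T-not-≡ᵇ⇒≢ : {m n : ℕ} → T (not (m ≡ᵇ n)) → m ≢ n
T-not-≡ᵇ⇒≢ {m} h refl with m ≡ᵇ m | ≡⇒≡ᵇ m m refl
... | true  | _  = h
... | false | ()

≢⇒≡ᵇ-false : {m n : ℕ} → m ≢ n → (m ≡ᵇ n) ≡ false
≢⇒≡ᵇ-false m≢n = to T-not-≡ (≢⇒T-not-≡ᵇ m≢n)

T-ext : {a b : Bool} → (T a → T b) → (T b → T a) → a ≡ b
T-ext {true}  {true}  _ _ = refl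
T-ext {true}  {false} a⇒b _ = ⊥-elim (a⇒b tt)
T-ext {false} {true}  _ b⇒a = ⊥-elim (b⇒a tt)
T-ext {false} {false} _ _ = refl

NoLoop : Edge → Set
NoLoop e = proj₁ e ≢ proj₂ e

NotSame : Edge → Edge → Set
NotSame e f = ¬ SameEdge e f

same-refl : (e : Edge) → SameEdge e e
same-refl e = inj₁ (refl , refl)

same-sym : {e f : Edge} → SameEdge e f → SameEdge f e
same-sym (inj₁ (refl , refl)) = inj₁ (refl , refl)
same-sym (inj₂ (refl , refl)) = inj₂ (refl , refl)

same-trans : {e f g : Edge} → SameEdge e f → SameEdge f g → SameEdge e g
same-trans (inj₁ (refl , refl)) f~g = f~g
same-trans (inj₂ (refl , refl)) (inj₁ (refl , refl)) = inj₂ (refl , refl)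
same-trans (inj₂ (refl , refl)) (inj₂ (refl , refl)) = inj₁ (refl , refl)

same-flip : {e : Edge} {a b : ℕ} → SameEdge e (a , b) → SameEdge e (b , a)
same-flip (inj₁ (refl , refl)) = inj₂ (refl , refl)
same-flip (inj₂ (refl , refl)) = inj₁ (refl , refl)

same-via : {f g : Edge} {a b : ℕ} → SameEdge f (a , b) → SameEdge g (a , b) → SameEdge f g
same-via f~ab g~ab = same-trans f~ab (same-sym g~ab)

notSame-sym : {e f : Edge} → NotSame e f → NotSame f e
notSame-sym e≁f f~e = e≁f (same-sym f~e)

same-loop : {e : Edge} {a : ℕ} → SameEdge e (a , a) → ¬ NoLoop e
same-loop (inj₁ (refl , refl)) e-noLoop = e-noLoop refl
same-loop (inj₂ (refl , refl)) e-noLoop = e-noLoop refl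

sameEdgeᵇ-sound : (e f : Edge) → T (sameEdgeᵇ e f) → SameEdge e f
sameEdgeᵇ-sound (a , b) (c , d) h with to T-∨ h
... | inj₁ h₁ = let (p , q) = to T-∧ h₁ in inj₁ (≡ᵇ⇒≡ a c p , ≡ᵇ⇒≡ b d q)
... | inj₂ h₂ = let (p , q) = to T-∧ h₂ in inj₂ (≡ᵇ⇒≡ a d p , ≡ᵇ⇒≡ b c q)

sameEdgeᵇ-complete : {e f : Edge} → SameEdge e f → T (sameEdgeᵇ e f)
sameEdgeᵇ-complete {a , b} (inj₁ (refl , refl)) = from T-∨ (inj₁ (from T-∧ (≡⇒≡ᵇ a a refl , ≡⇒≡ᵇ b b refl)))
sameEdgeᵇ-complete {a , b} (inj₂ (refl , refl)) = from T-∨ (inj₂ (from T-∧ (≡⇒≡ᵇ a a refl , ≡⇒≡ᵇ b b refl)))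

record Triangle (e₁ e₂ e₃ : Edge) : Set where
  constructor triangle
  field
    x y z : ℕ
    x≢y   : x ≢ y
    y≢z   : y ≢ z
    z≢x   : z ≢ x
    side₁ : SameEdge e₁ (x , y)
    side₂ : SameEdge e₂ (y , z)
    side₃ : SameEdge e₃ (z , x)

corners : {e₁ e₂ e₃ : Edge} → Triangle e₁ e₂ e₃ → ℕ × ℕ × ℕ
corners t = Triangle.x t , Triangle.y t , Triangle.z t

-- By definition, isTriangleᵇ (e₁ , e₂ , e₃) asks whether one of the four labellings
-- in candidates e₁ e₂ passes the test candidateᵇ e₁ e₂ e₃.
candidateᵇ : Edge → Edge → Edge → ℕ × ℕ × ℕ → Bool
candidateᵇ e₁ e₂ e₃ (u , v , w) =
  distinct3ᵇ u v w ∧ sameEdgeᵇ e₁ (u , v) ∧ sameEdgeᵇ e₂ (v , w) ∧ sameEdgeᵇ e₃ (w , u)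

candidates : Edge → Edge → List (ℕ × ℕ × ℕ)
candidates (a , b) (c , d) = (a , b , c) ∷ (a , b , d) ∷ (b , a , c) ∷ (b , a , d) ∷ []

candidate-sound : {e₁ e₂ e₃ : Edge} (c : ℕ × ℕ × ℕ) → T (candidateᵇ e₁ e₂ e₃ c) → Triangle e₁ e₂ e₃
candidate-sound (u , v , w) h =
  let (distinct , sides) = to T-∧ h
      (d₁ , d₂₃) = to T-∧ distinct ; (d₂ , d₃) = to T-∧ d₂₃
      (s₁ , s₂₃) = to T-∧ sides    ; (s₂ , s₃) = to T-∧ s₂₃
  in triangle u v w (T-not-≡ᵇ⇒≢ d₁) (T-not-≡ᵇ⇒≢ d₂) (T-not-≡ᵇ⇒≢ d₃)
                    (sameEdgeᵇ-sound _ _ s₁) (sameEdgeᵇ-sound _ _ s₂) (sameEdgeᵇ-sound _ _ s₃)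

candidate-complete : {e₁ e₂ e₃ : Edge} (t : Triangle e₁ e₂ e₃) → T (candidateᵇ e₁ e₂ e₃ (corners t))
candidate-complete (triangle x y z x≢y y≢z z≢x s₁ s₂ s₃) = from T-∧ (distinct , sides-ok)
  where
  distinct = from T-∧ (≢⇒T-not-≡ᵇ x≢y , from T-∧ (≢⇒T-not-≡ᵇ y≢z , ≢⇒T-not-≡ᵇ z≢x))
  sides-ok = from T-∧ (sameEdgeᵇ-complete s₁ , from T-∧ (sameEdgeᵇ-complete s₂ , sameEdgeᵇ-complete s₃))

corners-∈-candidates : {a b c d : ℕ} {e₃ : Edge} (t : Triangle (a , b) (c , d) e₃)
  → corners t ∈ candidates (a , b) (c , d)
corners-∈-candidates (triangle _ _ _ _ _ _ (inj₁ (refl , refl)) (inj₂ (refl , refl)) _) = here refl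
corners-∈-candidates (triangle _ _ _ _ _ _ (inj₁ (refl , refl)) (inj₁ (refl , refl)) _) = there (here refl)
corners-∈-candidates (triangle _ _ _ _ _ _ (inj₂ (refl , refl)) (inj₂ (refl , refl)) _) = there (there (here refl))
corners-∈-candidates (triangle _ _ _ _ _ _ (inj₂ (refl , refl)) (inj₁ (refl , refl)) _) =
  there (there (there (here refl)))

isTriangleᵇ-sound : (e₁ e₂ e₃ : Edge) → T (isTriangleᵇ (e₁ , e₂ , e₃)) → Triangle e₁ e₂ e₃
isTriangleᵇ-sound e₁ e₂ e₃ h =
  let (c , _ , hc) = find (any⁻ (candidateᵇ e₁ e₂ e₃) (candidates e₁ e₂) h) in candidate-sound c hc

isTriangleᵇ-complete : {e₁ e₂ e₃ : Edge} → Triangle e₁ e₂ e₃ → T (isTriangleᵇ (e₁ , e₂ , e₃))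
isTriangleᵇ-complete {e₁} {e₂} {e₃} t =
  any⁺ (candidateᵇ e₁ e₂ e₃) (lose (corners-∈-candidates t) (candidate-complete t))

triangle-swap₁₂ : {e₁ e₂ e₃ : Edge} → Triangle e₁ e₂ e₃ → Triangle e₂ e₁ e₃
triangle-swap₁₂ (triangle x y z x≢y y≢z z≢x s₁ s₂ s₃) =
  triangle z y x (y≢z ∘ sym) (x≢y ∘ sym) (z≢x ∘ sym) (same-flip s₂) (same-flip s₁) (same-flip s₃)

triangle-swap₂₃ : {e₁ e₂ e₃ : Edge} → Triangle e₁ e₂ e₃ → Triangle e₁ e₃ e₂
triangle-swap₂₃ (triangle x y z x≢y y≢z z≢x s₁ s₂ s₃) =
  triangle y x z (x≢y ∘ sym) (z≢x ∘ sym) (y≢z ∘ sym) (same-flip s₁) (same-flip s₃) (same-flip s₂)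

isTriangleᵇ-symmetric : Symmetric₃ isTriangleᵇ
isTriangleᵇ-symmetric =
  (λ a b c → T-ext (isTriangleᵇ-complete ∘ triangle-swap₁₂ ∘ isTriangleᵇ-sound a b c)
                   (isTriangleᵇ-complete ∘ triangle-swap₁₂ ∘ isTriangleᵇ-sound b a c)) ,
  (λ a b c → T-ext (isTriangleᵇ-complete ∘ triangle-swap₂₃ ∘ isTriangleᵇ-sound a b c)
                   (isTriangleᵇ-complete ∘ triangle-swap₂₃ ∘ isTriangleᵇ-sound a c b))

hasCornerᵇ-symmetric : (x : ℕ) → Symmetric₃ (hasCornerᵇ x)
hasCornerᵇ-symmetric x = swap₁₂ , swap₂₃
  where
  end = isEndpointᵇ x
  swap₁₂ : (a b c : Edge) → end a ∨ end b ∨ end c ≡ end b ∨ end a ∨ end c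
  swap₁₂ a b c = begin
    end a ∨ (end b ∨ end c)  ≡⟨ ∨-assoc (end a) (end b) (end c) ⟨
    (end a ∨ end b) ∨ end c  ≡⟨ cong (λ w → w ∨ end c) (∨-comm (end a) (end b)) ⟩
    (end b ∨ end a) ∨ end c  ≡⟨ ∨-assoc (end b) (end a) (end c) ⟩
    end b ∨ (end a ∨ end c)  ∎
    where open ≡-Reasoning
  swap₂₃ : (a b c : Edge) → end a ∨ end b ∨ end c ≡ end a ∨ end c ∨ end b
  swap₂₃ a b c = cong (λ w → end a ∨ w) (∨-comm (end b) (end c))

#Δ : List Edge → ℕ
#Δ S = length (triangles S)

#Δ_at : List Edge → ℕ → ℕ
#Δ S at x = length (trianglesAt S x)

#Δat-as-count : (S : List Edge) (x : ℕ)
  → #Δ S at x ≡ count (λ t → isTriangleᵇ t ∧ hasCornerᵇ x t) (choose3 S)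
#Δat-as-count S x = count-filter (hasCornerᵇ x) isTriangleᵇ (choose3 S)

#Δ-↭ : {S S′ : List Edge} → S ↭ S′ → #Δ S ≡ #Δ S′
#Δ-↭ = count-choose3-↭ isTriangleᵇ isTriangleᵇ-symmetric

#Δat-↭ : {S S′ : List Edge} → S ↭ S′ → (x : ℕ) → #Δ S at x ≡ #Δ S′ at x
#Δat-↭ {S} {S′} S↭S′ x = begin
  #Δ S at x                                                  ≡⟨ #Δat-as-count S x ⟩
  count (λ t → isTriangleᵇ t ∧ hasCornerᵇ x t) (choose3 S)   ≡⟨ count-choose3-↭ _ symmetric S↭S′ ⟩
  count (λ t → isTriangleᵇ t ∧ hasCornerᵇ x t) (choose3 S′)  ≡⟨ #Δat-as-count S′ x ⟨
  #Δ S′ at x                                                 ∎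
  where
  open ≡-Reasoning
  symmetric = ∧-symmetric₃ isTriangleᵇ-symmetric (hasCornerᵇ-symmetric x)

Adjacent : List Edge → ℕ → ℕ → Set
Adjacent S a b = ∃ λ f → f ∈ S × SameEdge f (a , b)

adjᵇ-sound : (S : List Edge) (a b : ℕ) → T (adjᵇ S a b) → Adjacent S a b
adjᵇ-sound S a b h =
  let (f , f∈S , hf) = find (any⁻ (λ e → sameEdgeᵇ e (a , b)) S h)
  in f , f∈S , sameEdgeᵇ-sound f (a , b) hf

adjᵇ-complete : {S : List Edge} {a b : ℕ} → Adjacent S a b → T (adjᵇ S a b)
adjᵇ-complete {a = a} {b} (f , f∈S , f~ab) =
  any⁺ (λ e → sameEdgeᵇ e (a , b)) (lose f∈S (sameEdgeᵇ-complete f~ab))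

endpoint-∈-vertices : (S : List Edge) {a b : ℕ} → Adjacent S a b → b ∈ vertices S
endpoint-∈-vertices ((p , q) ∷ S) (_ , here refl , inj₁ (refl , refl)) = there (here refl)
endpoint-∈-vertices ((p , q) ∷ S) (_ , here refl , inj₂ (refl , refl)) = here refl
endpoint-∈-vertices (_ ∷ S)       (f , there f∈S , f~ab)               =
  there (there (endpoint-∈-vertices S (f , f∈S , f~ab)))

∈-commonNbrs⁻ : (S : List Edge) (u v : ℕ) {c : ℕ} → c ∈ commonNbrs S u v → Adjacent S u c × Adjacent S c v
∈-commonNbrs⁻ S u v c∈N =
  let c∈filtered = ∈-deduplicate⁻ _≟_ (filterᵇ test (vertices S)) c∈N
      (_ , h) = ∈-filter⁻ (T? ∘ test) {xs = vertices S} c∈filtered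
      (u~c , c~v) = to T-∧ h
  in adjᵇ-sound S u _ u~c , adjᵇ-sound S _ v c~v
  where test = λ c → adjᵇ S u c ∧ adjᵇ S c v

∈-commonNbrs⁺ : (S : List Edge) (u v : ℕ) {c : ℕ} → Adjacent S u c → Adjacent S c v → c ∈ commonNbrs S u v
∈-commonNbrs⁺ S u v u~c c~v =
  ∈-deduplicate⁺ _≟_ (∈-filter⁺ (T? ∘ test) (endpoint-∈-vertices S u~c)
                                (from T-∧ (adjᵇ-complete u~c , adjᵇ-complete c~v)))
  where test = λ c → adjᵇ S u c ∧ adjᵇ S c v

commonNbr-≢ : {S : List Edge} → All NoLoop S → (u v : ℕ) {c : ℕ} → c ∈ commonNbrs S u v → c ≢ u × c ≢ v
commonNbr-≢ {S} loopFree u v c∈N with ∈-commonNbrs⁻ S u v c∈N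
... | (f , f∈S , f~uc) , (g , g∈S , g~cv) =
  (λ { refl → same-loop f~uc (All.lookup loopFree f∈S) }) ,
  (λ { refl → same-loop g~cv (All.lookup loopFree g∈S) })

commonNbrs-∷⁻ : {S : List Edge} {u v c : ℕ} → All NoLoop ((u , v) ∷ S)
  → c ∈ commonNbrs ((u , v) ∷ S) u v → c ∈ commonNbrs S u v
commonNbrs-∷⁻ {S} {u} {v} {c} loopFree c∈N
  with ∈-commonNbrs⁻ ((u , v) ∷ S) u v c∈N | commonNbr-≢ loopFree u v c∈N
... | u~c , c~v | c≢u , c≢v = ∈-commonNbrs⁺ S u v (drop-uv uv≁uc u~c) (drop-uv uv≁cv c~v)
  where
  drop-uv : {a b : ℕ} → NotSame (u , v) (a , b) → Adjacent ((u , v) ∷ S) a b → Adjacent S a b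
  drop-uv uv≁ab (_ , here refl , f~ab)  = ⊥-elim (uv≁ab f~ab)
  drop-uv _     (f , there f∈S , f~ab) = f , f∈S , f~ab
  uv≁uc : NotSame (u , v) (u , c)
  uv≁uc (inj₁ (_ , v≡c)) = c≢v (sym v≡c)
  uv≁uc (inj₂ (u≡c , _)) = c≢u (sym u≡c)
  uv≁cv : NotSame (u , v) (c , v)
  uv≁cv (inj₁ (u≡c , _)) = c≢u (sym u≡c)
  uv≁cv (inj₂ (_ , v≡c)) = c≢v (sym v≡c)

commonNbrs-∷⁺ : {S : List Edge} {u v c : ℕ} → c ∈ commonNbrs S u v → c ∈ commonNbrs ((u , v) ∷ S) u v
commonNbrs-∷⁺ {S} {u} {v} c∈N with ∈-commonNbrs⁻ S u v c∈N
... | (f , f∈S , f~uc) , (g , g∈S , g~cv) =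
  ∈-commonNbrs⁺ ((u , v) ∷ S) u v (f , there f∈S , f~uc) (g , there g∈S , g~cv)

-- Triangles through an edge uv

closesᵇ : ℕ → ℕ → Edge × Edge → Bool
closesᵇ u v (f , g) = isTriangleᵇ ((u , v) , f , g)

Apex : ℕ → ℕ → Edge → Edge → ℕ → Set
Apex u v f g c =
  c ≢ u × c ≢ v × ((SameEdge f (u , c) × SameEdge g (c , v)) ⊎ (SameEdge f (v , c) × SameEdge g (c , u)))

apexOf : ℕ → ℕ → Edge → ℕ
apexOf u v (a , b) = if (a ≡ᵇ u) ∨ (a ≡ᵇ v) then b else a

apex : ℕ → ℕ → Edge × Edge → ℕ
apex u v (f , g) = apexOf u v f

apexOf-spec : {u v a c : ℕ} {f : Edge} → SameEdge f (a , c) → a ≡ u ⊎ a ≡ v → c ≢ u → c ≢ v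
  → apexOf u v f ≡ c
apexOf-spec {a = a} (inj₁ (refl , refl)) (inj₁ refl) _ _ rewrite ≡ᵇ-refl a = refl
apexOf-spec {u} {a = a} (inj₁ (refl , refl)) (inj₂ refl) _ _ rewrite ≡ᵇ-refl a | ∨-zeroʳ (a ≡ᵇ u) = refl
apexOf-spec (inj₂ (refl , refl)) _ c≢u c≢v rewrite ≢⇒≡ᵇ-false c≢u | ≢⇒≡ᵇ-false c≢v = refl

Apex⇒apexOf : {u v c : ℕ} {f g : Edge} → Apex u v f g c → apexOf u v f ≡ c
Apex⇒apexOf (c≢u , c≢v , inj₁ (f~uc , _)) = apexOf-spec f~uc (inj₁ refl) c≢u c≢v
Apex⇒apexOf (c≢u , c≢v , inj₂ (f~vc , _)) = apexOf-spec f~vc (inj₂ refl) c≢u c≢v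

closes⇒Apex : (u v : ℕ) (f g : Edge) → T (closesᵇ u v (f , g)) → Apex u v f g (apexOf u v f)
closes⇒Apex u v f g h = subst (Apex u v f g) (sym (Apex⇒apexOf c-apex)) c-apex
  where
  apex-of-triangle : Triangle (u , v) f g → ∃ (Apex u v f g)
  apex-of-triangle (triangle _ _ z _ y≢z z≢x (inj₁ (refl , refl)) f~vz g~zu) =
    z , z≢x , y≢z ∘ sym , inj₂ (f~vz , g~zu)
  apex-of-triangle (triangle _ _ z _ y≢z z≢x (inj₂ (refl , refl)) f~uz g~zv) =
    z , y≢z ∘ sym , z≢x , inj₁ (f~uz , g~zv)
  c-apex = proj₂ (apex-of-triangle (isTriangleᵇ-sound (u , v) f g h))

Apex⇒closes : {u v c : ℕ} {f g : Edge} → u ≢ v → Apex u v f g c → T (closesᵇ u v (f , g))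
Apex⇒closes {u} {v} {c} u≢v (c≢u , c≢v , inj₁ (f~uc , g~cv)) =
  isTriangleᵇ-complete (triangle v u c (u≢v ∘ sym) (c≢u ∘ sym) c≢v (inj₂ (refl , refl)) f~uc g~cv)
Apex⇒closes {u} {v} {c} u≢v (c≢u , c≢v , inj₂ (f~vc , g~cu)) =
  isTriangleᵇ-complete (triangle u v c u≢v (c≢v ∘ sym) c≢u (same-refl _) f~vc g~cu)

Apex-unique : {u v c : ℕ} {f g f′ g′ : Edge} → Apex u v f g c → Apex u v f′ g′ c
  → (SameEdge f f′ × SameEdge g g′) ⊎ (SameEdge f g′ × SameEdge g f′)
Apex-unique (_ , _ , inj₁ (f~ , g~)) (_ , _ , inj₁ (f′~ , g′~)) = inj₁ (same-via f~ f′~ , same-via g~ g′~)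
Apex-unique (_ , _ , inj₂ (f~ , g~)) (_ , _ , inj₂ (f′~ , g′~)) = inj₁ (same-via f~ f′~ , same-via g~ g′~)
Apex-unique (_ , _ , inj₁ (f~ , g~)) (_ , _ , inj₂ (f′~ , g′~)) =
  inj₂ (same-via f~ (same-flip g′~) , same-via g~ (same-flip f′~))
Apex-unique (_ , _ , inj₂ (f~ , g~)) (_ , _ , inj₁ (f′~ , g′~)) =
  inj₂ (same-via f~ (same-flip g′~) , same-via g~ (same-flip f′~))

ApexDistinct : ℕ → ℕ → Edge × Edge → Edge × Edge → Set
ApexDistinct u v p q = T (closesᵇ u v p) → T (closesᵇ u v q) → apex u v p ≢ apex u v q

apexes-distinct : (u v : ℕ) (S : List Edge) → AllPairs NotSame S → AllPairs (ApexDistinct u v) (choose2 S)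
apexes-distinct u v []       []            = []
apexes-distinct u v (x ∷ xs) (x≁xs ∷ xs!) =
  AllPairsP.++⁺ (AllPairsP.map⁺ (AllPairs.map same-head xs!)) (apexes-distinct u v xs xs!)
                (AllP.map⁺ (All.tabulate (λ {y} _ → All.tabulate (different-heads {y}))))
  where
  -- pairs (x , y) and (x , y′) sharing an apex would force y ~ y′
  same-head : {y y′ : Edge} → NotSame y y′ → ApexDistinct u v (x , y) (x , y′)
  same-head {y} {y′} y≁y′ h h′ _ with Apex-unique (closes⇒Apex u v x y h) (closes⇒Apex u v x y′ h′)
  ... | inj₁ (_ , y~y′)      = y≁y′ y~y′
  ... | inj₂ (x~y′ , y~x)   = y≁y′ (same-trans y~x x~y′)
  -- a pair (x , y) and a pair (y₁ , y₂) from xs sharing an apex would force x ~ y₁ or x ~ y₂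
  different-heads : {y : Edge} {q : Edge × Edge} → q ∈ choose2 xs → ApexDistinct u v (x , y) q
  different-heads {y} {y₁ , y₂} q∈xs h h′ same with choose2-∈⁻ xs q∈xs
  ... | y₁∈xs , y₂∈xs
    with Apex-unique (closes⇒Apex u v x y h) (subst (Apex u v y₁ y₂) (sym same) (closes⇒Apex u v y₁ y₂ h′))
  ...   | inj₁ (x~y₁ , _) = All.lookup x≁xs y₁∈xs x~y₁
  ...   | inj₂ (x~y₂ , _) = All.lookup x≁xs y₂∈xs x~y₂

onTriangleᵇ : ℕ → ℕ → ℕ → ℕ → Bool
onTriangleᵇ u v x c = (x ≡ᵇ c) ∨ ((x ≡ᵇ u) ∨ (x ≡ᵇ v))

isEndpointᵇ-resp : (x : ℕ) {f : Edge} {a b : ℕ} → SameEdge f (a , b) → isEndpointᵇ x f ≡ (x ≡ᵇ a) ∨ (x ≡ᵇ b)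
isEndpointᵇ-resp x (inj₁ (refl , refl)) = refl
isEndpointᵇ-resp x {a = a} {b} (inj₂ (refl , refl)) = ∨-comm (x ≡ᵇ b) (x ≡ᵇ a)

-- hasCornerᵇ x ((u , v) , f , g) given the endpoint tests a, b of f and g.
sides : ℕ → ℕ → ℕ → Bool → Bool → Bool
sides u v x a b = ((x ≡ᵇ u) ∨ (x ≡ᵇ v)) ∨ (a ∨ b)

∨-sides₁ : (a b c : Bool) → (a ∨ b) ∨ ((a ∨ c) ∨ (c ∨ b)) ≡ c ∨ (a ∨ b)
∨-sides₁ true  b     c     = sym (∨-zeroʳ c)
∨-sides₁ false true  c     = sym (∨-zeroʳ c)
∨-sides₁ false false true  = refl
∨-sides₁ false false false = refl

∨-sides₂ : (a b c : Bool) → (a ∨ b) ∨ ((b ∨ c) ∨ (c ∨ a)) ≡ c ∨ (a ∨ b)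
∨-sides₂ true  b     c     = sym (∨-zeroʳ c)
∨-sides₂ false true  c     = sym (∨-zeroʳ c)
∨-sides₂ false false true  = refl
∨-sides₂ false false false = refl

hasCorner-closing : (u v x : ℕ) (p : Edge × Edge)
  → (closesᵇ u v p ∧ hasCornerᵇ x ((u , v) , p)) ≡ (closesᵇ u v p ∧ onTriangleᵇ u v x (apex u v p))
hasCorner-closing u v x (f , g) with closesᵇ u v (f , g) in closes
... | false = refl
... | true with closes⇒Apex u v f g (from T-≡ closes)
...   | _ , _ , inj₁ (f~uc , g~cv) =
  trans (cong₂ (sides u v x) (isEndpointᵇ-resp x f~uc) (isEndpointᵇ-resp x g~cv))
        (∨-sides₁ (x ≡ᵇ u) (x ≡ᵇ v) (x ≡ᵇ apexOf u v f))
...   | _ , _ , inj₂ (f~vc , g~cu) =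
  trans (cong₂ (sides u v x) (isEndpointᵇ-resp x f~vc) (isEndpointᵇ-resp x g~cu))
        (∨-sides₂ (x ≡ᵇ u) (x ≡ᵇ v) (x ≡ᵇ apexOf u v f))

-- The triangles created by adding an edge uv to a sample S

module NewEdge (u v : ℕ) (u≢v : u ≢ v) (S : List Edge) (loopFree : All NoLoop S) (simple : AllPairs NotSame S)
  where

  N : List ℕ
  N = commonNbrs S u v

  apexes : List ℕ
  apexes = map (apex u v) (filterᵇ (closesᵇ u v) (choose2 S))

  apex-∈-apexes : {f g : Edge} {c : ℕ} → (f , g) ∈ choose2 S → Apex u v f g c → c ∈ apexes
  apex-∈-apexes fg∈S c-apex =
    subst (_∈ apexes) (Apex⇒apexOf c-apex)
          (∈-map⁺ (apex u v) (∈-filter⁺ (T? ∘ closesᵇ u v) fg∈S (Apex⇒closes u≢v c-apex)))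

  sides-differ : {f g : Edge} {c : ℕ} → SameEdge f (u , c) → SameEdge g (c , v) → c ≢ u → f ≢ g
  sides-differ f~uc g~cv c≢u refl with same-trans (same-sym f~uc) g~cv
  ... | inj₁ (u≡c , _) = c≢u (sym u≡c)
  ... | inj₂ (u≡v , _) = u≢v u≡v

  apexes⊆N : {c : ℕ} → c ∈ apexes → c ∈ N
  apexes⊆N c∈ with ∈-map⁻ (apex u v) c∈
  ... | (f , g) , fg∈ , refl with ∈-filter⁻ (T? ∘ closesᵇ u v) {xs = choose2 S} fg∈
  ...   | fg∈S , closes with choose2-∈⁻ S fg∈S | closes⇒Apex u v f g closes
  ...     | f∈S , g∈S | _ , _ , inj₁ (f~uc , g~cv) =
    ∈-commonNbrs⁺ S u v (f , f∈S , f~uc) (g , g∈S , g~cv)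
  ...     | f∈S , g∈S | _ , _ , inj₂ (f~vc , g~cu) =
    ∈-commonNbrs⁺ S u v (g , g∈S , same-flip g~cu) (f , f∈S , same-flip f~vc)

  N⊆apexes : {c : ℕ} → c ∈ N → c ∈ apexes
  N⊆apexes c∈N with ∈-commonNbrs⁻ S u v c∈N | commonNbr-≢ loopFree u v c∈N
  ... | (f , f∈S , f~uc) , (g , g∈S , g~cv) | c≢u , c≢v
    with choose2-∈⁺ S f∈S g∈S (sides-differ f~uc g~cv c≢u)
  ...   | inj₁ fg∈S = apex-∈-apexes fg∈S (c≢u , c≢v , inj₁ (f~uc , g~cv))
  ...   | inj₂ gf∈S = apex-∈-apexes gf∈S (c≢u , c≢v , inj₂ (same-flip g~cv , same-flip f~uc))

  apexes-unique : Unique apexes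
  apexes-unique = AllPairsP.map⁺ (AllPairs-discharge guarded (AllP.all-filter (T? ∘ closesᵇ u v) (choose2 S)))
    where guarded = AllPairsP.filter⁺ (T? ∘ closesᵇ u v) (apexes-distinct u v S simple)

  count-closing : (h : ℕ → Bool) → count (λ p → closesᵇ u v p ∧ h (apex u v p)) (choose2 S) ≡ count h N
  count-closing h = begin
    count (λ p → closesᵇ u v p ∧ h (apex u v p)) (choose2 S)  ≡⟨ count-filter (h ∘ apex u v) (closesᵇ u v) (choose2 S) ⟨
    count (h ∘ apex u v) closing                             ≡⟨ count-map h (apex u v) closing ⟨
    count h apexes                                           ≡⟨ count-↭ h apexes↭N ⟩
    count h N                                                ∎
    where
    open ≡-Reasoning
    closing = filterᵇ (closesᵇ u v) (choose2 S)
    apexes↭N = same-members⇒↭ apexes-unique (deduplicate-! _) apexes⊆N N⊆apexes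

  #Δ-∷ : #Δ ((u , v) ∷ S) ≡ length N + #Δ S
  #Δ-∷ = begin
    #Δ ((u , v) ∷ S)                                       ≡⟨ count-choose3-∷ isTriangleᵇ (u , v) S ⟩
    count (closesᵇ u v) (choose2 S) + #Δ S                 ≡⟨ cong (λ n → n + #Δ S) (count-ext _ _ and-true (choose2 S)) ⟩
    count (λ p → closesᵇ u v p ∧ true) (choose2 S) + #Δ S  ≡⟨ cong (λ n → n + #Δ S) (count-closing (λ _ → true)) ⟩
    count (λ _ → true) N + #Δ S                            ≡⟨ cong (λ n → n + #Δ S) (count-true N) ⟩
    length N + #Δ S                                        ∎
    where
    open ≡-Reasoning
    and-true = λ p → sym (∧-identityʳ (closesᵇ u v p))

  #Δat-∷ : (x : ℕ) → #Δ ((u , v) ∷ S) at x ≡ count (onTriangleᵇ u v x) N + #Δ S at x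
  #Δat-∷ x = begin
    #Δ ((u , v) ∷ S) at x
      ≡⟨ #Δat-as-count ((u , v) ∷ S) x ⟩
    count corner-test (choose3 ((u , v) ∷ S))
      ≡⟨ count-choose3-∷ corner-test (u , v) S ⟩
    count (λ p → closesᵇ u v p ∧ hasCornerᵇ x ((u , v) , p)) (choose2 S) + count corner-test (choose3 S)
      ≡⟨ cong₂ _+_ (count-ext _ _ (hasCorner-closing u v x) (choose2 S)) (sym (#Δat-as-count S x)) ⟩
    count (λ p → closesᵇ u v p ∧ onTriangleᵇ u v x (apex u v p)) (choose2 S) + #Δ S at x
      ≡⟨ cong (λ n → n + #Δ S at x) (count-closing (onTriangleᵇ u v x)) ⟩
    count (onTriangleᵇ u v x) N + #Δ S at x
      ∎
    where
    open ≡-Reasoning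
    corner-test = λ t → isTriangleᵇ t ∧ hasCornerᵇ x t

counterStep : ℤ → ℕ → ℕ → State → ℕ → State
counterStep s u v σ c = st (sample σ) (τ σ ℤ.+ s) (bump s v (bump s u (bump s c (local σ))))

bump-corners : (s : ℤ) {u v c : ℕ} (f : ℕ → ℤ) (y : ℕ) → c ≢ u → c ≢ v → u ≢ v
  → bump s v (bump s u (bump s c f)) y ≡ (if onTriangleᵇ u v y c then f y ℤ.+ s else f y)
bump-corners s {u} {v} {c} f y c≢u c≢v u≢v with y ≡ᵇ c in y≡c | y ≡ᵇ u in y≡u | y ≡ᵇ v in y≡v
... | true  | true  | _     = ⊥-elim (c≢u (≡ᵇ-true-unique y y≡c y≡u))
... | true  | false | true  = ⊥-elim (c≢v (≡ᵇ-true-unique y y≡c y≡v))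
... | false | true  | true  = ⊥-elim (u≢v (≡ᵇ-true-unique y y≡u y≡v))
... | true  | false | false = refl
... | false | true  | false = refl
... | false | false | true  = refl
... | false | false | false = refl

*-suc-ℤ : (s : ℤ) (n : ℕ) → s ℤ.* + suc n ≡ s ℤ.+ s ℤ.* + n
*-suc-ℤ s n = trans (ℤP.*-distribˡ-+ s (+ 1) (+ n)) (cong (λ i → i ℤ.+ s ℤ.* + n) (ℤP.*-identityʳ s))

conditional-add : (b : Bool) (l s : ℤ) (n : ℕ)
  → (if b then l ℤ.+ s else l) ℤ.+ s ℤ.* + n ≡ l ℤ.+ s ℤ.* + (bit b + n)
conditional-add true  l s n = trans (ℤP.+-assoc l s (s ℤ.* + n)) (cong (λ i → l ℤ.+ i) (sym (*-suc-ℤ s n)))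
conditional-add false l s n = refl

record Updated (s : ℤ) (u v : ℕ) (cs : List ℕ) (σ σ′ : State) : Set where
  field
    τ-updated     : τ σ′ ≡ τ σ ℤ.+ s ℤ.* + length cs
    local-updated : (y : ℕ) → local σ′ y ≡ local σ y ℤ.+ s ℤ.* + count (onTriangleᵇ u v y) cs

run-counterSteps : (s : ℤ) {u v : ℕ} → u ≢ v → (cs : List ℕ) → All (λ c → c ≢ u × c ≢ v) cs
  → (σ : State) → Updated s u v cs σ (foldl (counterStep s u v) σ cs)
run-counterSteps s u≢v [] [] σ = record
  { τ-updated     = sym (plus-nothing (τ σ))
  ; local-updated = λ y → sym (plus-nothing (local σ y))
  }
  where
  plus-nothing : (i : ℤ) → i ℤ.+ s ℤ.* + 0 ≡ i
  plus-nothing i = trans (cong (λ j → i ℤ.+ j) (ℤP.*-zeroʳ s)) (ℤP.+-identityʳ i)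
run-counterSteps s {u} {v} u≢v (c ∷ cs) ((c≢u , c≢v) ∷ cs-ok) σ = record
  { τ-updated     = trans (Updated.τ-updated rest) (conditional-add true (τ σ) s (length cs))
  ; local-updated = local-updated
  }
  where
  σ₁ = counterStep s u v σ c
  rest = run-counterSteps s u≢v cs cs-ok σ₁
  local-updated : (y : ℕ) → local (foldl (counterStep s u v) σ₁ cs) y
                            ≡ local σ y ℤ.+ s ℤ.* + count (onTriangleᵇ u v y) (c ∷ cs)
  local-updated y = begin
    local (foldl (counterStep s u v) σ₁ cs) y
      ≡⟨ Updated.local-updated rest y ⟩
    bump s v (bump s u (bump s c (local σ))) y ℤ.+ s ℤ.* + count (onTriangleᵇ u v y) cs
      ≡⟨ cong (λ l → l ℤ.+ s ℤ.* + count (onTriangleᵇ u v y) cs) (bump-corners s (local σ) y c≢u c≢v u≢v) ⟩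
    (if onTriangleᵇ u v y c then local σ y ℤ.+ s else local σ y) ℤ.+ s ℤ.* + count (onTriangleᵇ u v y) cs
      ≡⟨ conditional-add (onTriangleᵇ u v y c) (local σ y) s _ ⟩
    local σ y ℤ.+ s ℤ.* + (bit (onTriangleᵇ u v y c) + count (onTriangleᵇ u v y) cs)
      ≡⟨ cong (λ n → local σ y ℤ.+ s ℤ.* + n) (count-∷ (onTriangleᵇ u v y) c cs) ⟨
    local σ y ℤ.+ s ℤ.* + count (onTriangleᵇ u v y) (c ∷ cs)
      ∎
    where open ≡-Reasoning

add-count : (n a : ℕ) → + a ℤ.+ signℤ plus ℤ.* + n ≡ + (n + a)
add-count n a = trans (cong (λ i → + a ℤ.+ i) (ℤP.*-identityˡ (+ n))) (cong +_ (+-comm a n))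

subtract-count : (n a : ℕ) → + (n + a) ℤ.+ signℤ minus ℤ.* + n ≡ + a
subtract-count n a = begin
  + (n + a) ℤ.+ -1ℤ ℤ.* + n        ≡⟨ cong₂ ℤ._+_ (cong +_ (+-comm n a)) (ℤP.-1*i≡-i (+ n)) ⟩
  (+ a ℤ.+ + n) ℤ.+ ℤ.- (+ n)      ≡⟨ ℤP.+-assoc (+ a) (+ n) (ℤ.- (+ n)) ⟩
  + a ℤ.+ (+ n ℤ.+ ℤ.- (+ n))      ≡⟨ cong (λ i → + a ℤ.+ i) (ℤP.+-inverseʳ (+ n)) ⟩
  + a ℤ.+ + 0                      ≡⟨ ℤP.+-identityʳ (+ a) ⟩
  + a                              ∎
  where open ≡-Reasoning

corrected-after-insert : {i : ℤ} {a n n′ b : ℕ} → i ≡ + a → n ≡ n′ → b ≡ n′ + a → i ℤ.+ signℤ plus ℤ.* + n ≡ + b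
corrected-after-insert {a = a} {n} refl refl refl = add-count n a

corrected-after-remove : {i : ℤ} {a n b : ℕ} → i ≡ + a → a ≡ n + b → i ℤ.+ signℤ minus ℤ.* + n ≡ + b
corrected-after-remove {n = n} {b} refl refl = subtract-count n b

updateCounters-sample : (sg : Sign) (e : Edge) (σ : State) → sample (updateCounters sg e σ) ≡ sample σ
updateCounters-sample sg (u , v) σ = steps-keep-sample (commonNbrs (sample σ) u v) σ
  where
  steps-keep-sample : (cs : List ℕ) (σ′ : State)
    → sample (foldl (counterStep (signℤ sg) u v) σ′ cs) ≡ sample σ′
  steps-keep-sample []       σ′ = refl
  steps-keep-sample (c ∷ cs) σ′ = steps-keep-sample cs (counterStep (signℤ sg) u v σ′ c)

-- The invariant of TRIÈST-BASE

record Invariant (σ : State) : Set where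
  field
    loopFree    : All NoLoop (sample σ)
    simple      : AllPairs NotSame (sample σ)
    τ-exact     : τ σ ≡ + #Δ (sample σ)
    local-exact : (x : ℕ) → local σ x ≡ + #Δ (sample σ) at x
open Invariant

invariant-via : (σ : State) {S : List Edge} → sample σ ≡ S → All NoLoop S → AllPairs NotSame S
  → τ σ ≡ + #Δ S → ((x : ℕ) → local σ x ≡ + #Δ S at x) → Invariant σ
invariant-via σ refl loopFree simple τ-exact local-exact =
  record { loopFree = loopFree ; simple = simple ; τ-exact = τ-exact ; local-exact = local-exact }

initial-invariant : Invariant initState
initial-invariant = record { loopFree = [] ; simple = [] ; τ-exact = refl ; local-exact = λ _ → refl }

insert-preserves : (σ : State) (e : Edge) → Invariant σ → NoLoop e → All (NotSame e) (sample σ)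
  → Invariant (updateCounters plus e (insertEdge e σ))
insert-preserves σ (u , v) inv u≢v uv-fresh =
  invariant-via σ′ (updateCounters-sample plus (u , v) σ₀) loopFree⁺ (uv-fresh ∷ simple inv) τ-ok local-ok
  where
  open NewEdge u v u≢v (sample σ) (loopFree inv) (simple inv)
  σ₀ = insertEdge (u , v) σ
  σ′ = updateCounters plus (u , v) σ₀
  loopFree⁺ = u≢v ∷ loopFree inv
  -- the loop runs over 𝒩 of the enlarged sample, which is a permutation of N
  cs = commonNbrs (sample σ₀) u v
  cs↭N : cs ↭ N
  cs↭N = same-members⇒↭ (deduplicate-! _) (deduplicate-! _)
                        (commonNbrs-∷⁻ loopFree⁺) (commonNbrs-∷⁺ {sample σ} {u} {v})
  updated = run-counterSteps (signℤ plus) u≢v cs (All.tabulate (commonNbr-≢ loopFree⁺ u v)) σ₀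
  τ-ok : τ σ′ ≡ + #Δ ((u , v) ∷ sample σ)
  τ-ok = trans (Updated.τ-updated updated) (corrected-after-insert (τ-exact inv) (↭-length cs↭N) #Δ-∷)
  local-ok : (x : ℕ) → local σ′ x ≡ + #Δ ((u , v) ∷ sample σ) at x
  local-ok x = trans (Updated.local-updated updated x)
                     (corrected-after-insert (local-exact inv x) (count-↭ (onTriangleᵇ u v x) cs↭N) (#Δat-∷ x))

remove-preserves : (σ : State) (i : Fin (length (sample σ))) → Invariant σ
  → Invariant (updateCounters minus (lookup (sample σ) i) (st (removeAt (sample σ) i) (τ σ) (local σ)))
remove-preserves σ i inv =
  invariant-via σ₁ (updateCounters-sample minus e σ₀) loopFree⁻ simple⁻ τ-ok local-ok
  where
  S = sample σ
  e = lookup S i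
  S⁻ = removeAt S i
  σ₀ = st S⁻ (τ σ) (local σ)
  σ₁ = updateCounters minus e σ₀
  u≢v : NoLoop e
  u≢v = All.head (All-resp-↭ (lookup-removeAt-↭ S i) (loopFree inv))
  loopFree⁻ = All-removeAt S i (loopFree inv)
  simple⁻ = proj₂ (removeAt-AllPairs notSame-sym S i (simple inv))
  open NewEdge (proj₁ e) (proj₂ e) u≢v S⁻ loopFree⁻ simple⁻
  N-ok = All.tabulate (commonNbr-≢ loopFree⁻ (proj₁ e) (proj₂ e))
  updated = run-counterSteps (signℤ minus) u≢v N N-ok σ₀
  -- S is a permutation of e ∷ S⁻, so its counts split as in NewEdge
  #Δ-split : #Δ S ≡ length N + #Δ S⁻
  #Δ-split = trans (#Δ-↭ (lookup-removeAt-↭ S i)) #Δ-∷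
  τ-ok : τ σ₁ ≡ + #Δ S⁻
  τ-ok = trans (Updated.τ-updated updated) (corrected-after-remove (τ-exact inv) #Δ-split)
  local-ok : (x : ℕ) → local σ₁ x ≡ + #Δ S⁻ at x
  local-ok x = trans (Updated.local-updated updated x) (corrected-after-remove (local-exact inv x) #Δat-split)
    where
    #Δat-split : #Δ S at x ≡ count (onTriangleᵇ (proj₁ e) (proj₂ e) x) N + #Δ S⁻ at x
    #Δat-split = trans (#Δat-↭ (lookup-removeAt-↭ S i) x) (#Δat-∷ x)

record StepCorrect (e : Edge) (σ : State) (result : List State × State) : Set₁ where
  field
    reported-ok : All Invariant (proj₁ result)
    final-ok    : Invariant (proj₂ result)
    sample-⊆    : {P : Edge → Set} → P e → All P (sample σ) → All P (sample (proj₂ result))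

step-correct : (M : ℕ) (ch : Choices) (t : ℕ) (e : Edge) (σ : State) → Invariant σ
  → NoLoop e → All (NotSame e) (sample σ) → StepCorrect e σ (step M ch t e σ)
step-correct M ch t e σ inv e-noLoop e-fresh with t ≤ᵇ M
... | true = record
  { reported-ok = inserted ∷ []
  ; final-ok    = inserted
  ; sample-⊆    = λ {P} Pe PS → subst (All P) (sym (updateCounters-sample plus e (insertEdge e σ))) (Pe ∷ PS)
  }
  where inserted = insert-preserves σ e inv e-noLoop e-fresh
... | false with ch t (sample σ)
...   | nothing = record { reported-ok = [] ; final-ok = inv ; sample-⊆ = λ _ PS → PS }
...   | just i  = record
  { reported-ok = removed ∷ inserted ∷ []
  ; final-ok    = inserted
  ; sample-⊆    = λ {P} Pe PS → subst (All P) (sym (updateCounters-sample plus e (insertEdge e σ₁)))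
                                  (Pe ∷ subst (All P) (sym sample₁) (All-removeAt (sample σ) i PS))
  }
  where
  σ₁ = updateCounters minus (lookup (sample σ) i) (st (removeAt (sample σ) i) (τ σ) (local σ))
  sample₁ : sample σ₁ ≡ removeAt (sample σ) i
  sample₁ = updateCounters-sample minus (lookup (sample σ) i) (st (removeAt (sample σ) i) (τ σ) (local σ))
  removed = remove-preserves σ i inv
  e-fresh₁ = subst (All (NotSame e)) (sym sample₁) (All-removeAt (sample σ) i e-fresh)
  inserted = insert-preserves σ₁ e removed e-noLoop e-fresh₁

Fresh : List Edge → List Edge → Set
Fresh es S = All (λ f → All (NotSame f) S) es

fresh-after-step : {e : Edge} {S S′ : List Edge} (es : List Edge) → All (NotSame e) es → Fresh es S
  → ({P : Edge → Set} → P e → All P S → All P S′) → Fresh es S′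
fresh-after-step []       []            []            sample-⊆ = []
fresh-after-step (f ∷ es) (e≁f ∷ e≁es) (f≁S ∷ es≁S) sample-⊆ =
  sample-⊆ {NotSame f} (notSame-sym e≁f) f≁S ∷ fresh-after-step es e≁es es≁S sample-⊆

run-correct : (M : ℕ) (ch : Choices) (t : ℕ) (σ : State) (es : List Edge) → Invariant σ
  → All NoLoop es → AllPairs NotSame es → Fresh es (sample σ) → {σ′ : State} → σ′ ∈ runFrom M ch t σ es
  → Invariant σ′
run-correct M ch t σ (e ∷ es) inv (e-noLoop ∷ es-noLoop) (e≁es ∷ es-simple) (e-fresh ∷ es-fresh) σ′∈
  with step M ch t e σ | step-correct M ch t e σ inv e-noLoop e-fresh
... | reported , σₙ | ok with ∈-++⁻ reported σ′∈
...   | inj₁ σ′∈reported = All.lookup (StepCorrect.reported-ok ok) σ′∈reported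
...   | inj₂ σ′∈later    = run-correct M ch (suc t) σₙ es (StepCorrect.final-ok ok) es-noLoop es-simple
                             (fresh-after-step es e≁es es-fresh (StepCorrect.sample-⊆ ok)) σ′∈later

lemma4p3 : (M : ℕ) → 6 ≤ M → (stream : List Edge)
    → All (λ e → proj₁ e ≢ proj₂ e) stream
    → AllPairs (λ e f → ¬ SameEdge e f) stream
    → (ch : Choices) → (σ : State) → σ ∈ trace M ch stream
    → (τ σ ≡ + length (triangles (sample σ)))
      × ((v : ℕ) → v ∈ vertices (sample σ) → 1 ≤ length (trianglesAt (sample σ) v)
         → local σ v ≡ + length (trianglesAt (sample σ) v))
lemma4p3 M _ stream stream-noLoop stream-simple ch σ σ∈trace = τ-exact inv , λ v _ _ → local-exact inv v
  where
  inv = run-correct M ch 1 initState stream initial-invariant stream-noLoop stream-simple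
                    (All.universal (λ _ → []) stream) σ∈trace
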